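{- Set $m_{\frac01}=1$ and $m_{\frac12}=13$. Then for $q\ge3$, \[ m_{\frac{q-1}q}=17\,m_{\frac{q-2}{q-1}}-m_{\frac{q-3}{q-2}}-3. \]
   Context: Generalized Markov numbers $m_{\frac pq}$ for reduced $\tfrac pq\in(0,1]$. Start from three positions with labels $\tfrac01,\tfrac10,\tfrac{ -1}1$, each carrying the number $1$. Mutating a position with label $\tfrac ef$ and number $z$, where the other two positions have labels $\tfrac ab,\tfrac cd$ and numbers $x,y$, does two things. It replaces the label by $\tfrac{a+c}{b+d}$, or by $\tfrac{c-a}{d-b}$ if $\tfrac ef=\tfrac{a+c}{b+d}$. It replaces $z$ by $(x^2+xy+y^2)/z$. Consider mutation sequences starting with position $\tfrac{ -1}1$, then $\tfrac10$, never mutating the same position twice in a row. Every reduced $\tfrac pq\in(0,1]$ occurs as a label, always carrying the same number $m_{\frac pq}$. The resulting triples are positive integer solutions of $x^2+y^2+z^2+xy+xz+yz=6xyz$; $m_{\frac11}=3$. -}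

module Defs where

open import Data.Nat as ℕ using (ℕ; zero; suc; NonZero)
open import Data.Nat.DivMod using (_/_)
open import Data.Integer as ℤ using (ℤ; +_; -[1+_])
open import Data.Fin using (Fin; zero; suc)
open import Data.Product using (_×_; _,_; proj₁; proj₂; Σ; ∃; ∃-syntax)
open import Relation.Nullary using (yes; no; ¬_)
open import Relation.Binary.PropositionalEquality using (_≡_)

-- A label e/f is stored as a pair (e , f) of integers (1/0 is allowed).
Label : Set
Label = ℤ × ℤ

_≈F_ : Label → Label → Set
(e , f) ≈F (a , b) = e ℤ.* b ≡ f ℤ.* a

record State : Set where
  constructor st
  field
    lab : Fin 3 → Label
    num : Fin 3 → ℕ
open State public

other₁ other₂ : Fin 3 → Fin 3
other₁ zero = suc zero
other₁ (suc zero) = zero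
other₁ (suc (suc zero)) = zero
other₂ zero = suc (suc zero)
other₂ (suc zero) = suc (suc zero)
other₂ (suc (suc zero)) = suc zero

-- natural-number division (exact on all reachable states); guarded against 0
_div_ : ℕ → ℕ → ℕ
x div zero = zero
x div suc z = x / suc z

newLabel : Label → Label → Label → Label
newLabel (a , b) (c , d) (e , f) with (e ℤ.* (b ℤ.+ d)) ℤ.≟ (f ℤ.* (a ℤ.+ c))
... | yes _ = (c ℤ.- a , d ℤ.- b)
... | no  _ = (a ℤ.+ c , b ℤ.+ d)

newNum : ℕ → ℕ → ℕ → ℕ
newNum x y z = (x ℕ.* x ℕ.+ x ℕ.* y ℕ.+ y ℕ.* y) div z

update : {A : Set} → Fin 3 → A → (Fin 3 → A) → Fin 3 → A
update zero v g zero = v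
update zero v g (suc i) = g (suc i)
update (suc zero) v g zero = g zero
update (suc zero) v g (suc zero) = v
update (suc zero) v g (suc (suc zero)) = g (suc (suc zero))
update (suc (suc zero)) v g zero = g zero
update (suc (suc zero)) v g (suc zero) = g (suc zero)
update (suc (suc zero)) v g (suc (suc zero)) = v

mutate : Fin 3 → State → State
mutate k s =
  st (update k (newLabel (lab s (other₁ k)) (lab s (other₂ k)) (lab s k)) (lab s))
     (update k (newNum (num s (other₁ k)) (num s (other₂ k)) (num s k)) (num s))

initial : State
initial = st lab₀ (λ _ → 1)
  where
  lab₀ : Fin 3 → Label
  lab₀ zero = (+ 0 , + 1)
  lab₀ (suc zero) = (+ 1 , + 0)
  lab₀ (suc (suc zero)) = (-[1+ 0 ] , + 1)

pos-1/1 pos1/0 : Fin 3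
pos-1/1 = suc (suc zero)
pos1/0 = suc zero

state₁ state₂ : State
state₁ = mutate pos-1/1 initial
state₂ = mutate pos1/0 state₁

data ReachFrom : State → Fin 3 → Set where
  base : ReachFrom state₂ pos1/0
  step : ∀ {s i} (j : Fin 3) → ReachFrom s i → ¬ (j ≡ i) → ReachFrom (mutate j s) j

data Reachable : State → Set where
  r-init : Reachable initial
  r-one  : Reachable state₁
  r-more : ∀ {s i} → ReachFrom s i → Reachable s

HasM : ℕ → ℕ → ℕ → Set
HasM p q n = Σ State λ s → Reachable s × ∃[ k ]
  ((lab s k ≈F (+ p , + q)) × num s k ≡ n)

-- The labels u/(u+1) are the Farey neighbours of 1/1. The first two mutations give the
-- labels (0/1, 1/2, 1/1) with numbers (1, 13, 3). While the position of 1/1 is left alone,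
-- every mutation turns t/(t+1) into (t+2)/(t+3), and its number is the Vieta jump of x in
-- the Markov-type equation with z = 3, namely 17y − x − 3. Once 1/1 is mutated while its
-- neighbours are t/(t+1) and (t+1)/(t+2), every later label is a mediant strictly between
-- these two, so no further label of the form u/(u+1) ever appears. Hence m_{u/(u+1)} is the
-- sequence 1, 13, 217, … satisfying the recurrence.
module Submission where

open import Data.Empty using (⊥-elim)
open import Data.Fin using (Fin; zero; suc)
import Data.Integer as ℤ
import Data.Integer.Properties as ℤ
open import Data.List using ([]; _∷_)
open import Data.Nat using (ℕ; zero; suc; _+_; _*_; _∸_; _≤_; _<_; s≤s; s≤s⁻¹; z≤n; NonZero)
open import Data.Nat.DivMod using (m*n/n≡m)
open import Data.Nat.Properties
open import Data.Nat.Tactic.RingSolver using (solve)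
open import Data.Product using (_×_; _,_; proj₁; proj₂)
open import Data.Sum using (_⊎_; inj₁; inj₂)
open import Function using (_∘_)
open import Relation.Binary.PropositionalEquality
open import Relation.Nullary using (¬_; yes; no; contradiction)

open import Defs

-- Vieta jumping

record Markov (x y z : ℕ) : Set where
  constructor markov
  field
    equation : x * x + y * y + z * z + x * y + x * z + y * z ≡ 6 * x * y * z

Markov-swap : ∀ {x y z} → Markov x y z → Markov y x z
Markov-swap {x} {y} {z} (markov equation) = markov (begin
  y * y + x * x + z * z + y * x + y * z + x * z ≡⟨ solve (x ∷ y ∷ z ∷ []) ⟩
  x * x + y * y + z * z + x * y + x * z + y * z ≡⟨ equation ⟩
  6 * x * y * z                                 ≡⟨ solve (x ∷ y ∷ z ∷ []) ⟩
  6 * y * x * z                                 ∎)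
  where open ≡-Reasoning

module _ {x y z w : ℕ} (sum : w + x + y + z ≡ 6 * y * z) (solution : Markov x y z) where
  open ≡-Reasoning
  open Markov solution

  vieta-product : x * w ≡ y * y + y * z + z * z
  vieta-product = +-cancelˡ-≡ (x * x + x * y + x * z) _ _ (begin
    x * x + x * y + x * z + x * w                 ≡⟨ solve (x ∷ y ∷ z ∷ w ∷ []) ⟩
    x * (w + x + y + z)                           ≡⟨ cong (x *_) sum ⟩
    x * (6 * y * z)                               ≡⟨ solve (x ∷ y ∷ z ∷ []) ⟩
    6 * x * y * z                                 ≡⟨ equation ⟨
    x * x + y * y + z * z + x * y + x * z + y * z ≡⟨ solve (x ∷ y ∷ z ∷ []) ⟩
    x * x + x * y + x * z + (y * y + y * z + z * z) ∎)

  vieta-markov : Markov w y z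
  vieta-markov = markov (begin
    w * w + y * y + z * z + w * y + w * z + y * z   ≡⟨ solve (w ∷ y ∷ z ∷ []) ⟩
    w * w + w * y + w * z + (y * y + y * z + z * z)
      ≡⟨ cong (w * w + w * y + w * z +_) vieta-product ⟨
    w * w + w * y + w * z + x * w                   ≡⟨ solve (x ∷ y ∷ z ∷ w ∷ []) ⟩
    w * (w + x + y + z)                             ≡⟨ cong (w *_) sum ⟩
    w * (6 * y * z)                                 ≡⟨ solve (y ∷ z ∷ w ∷ []) ⟩
    6 * w * y * z                                   ∎)

  vieta-newNum : 1 ≤ x → newNum y z x ≡ w
  vieta-newNum (s≤s _) = begin
    (y * y + y * z + z * z) div x ≡⟨ cong (_div x) vieta-product ⟨
    (x * w) div x                 ≡⟨ cong (_div x) (*-comm x w) ⟩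
    (w * x) div x                 ≡⟨ m*n/n≡m w x ⟩
    w                             ∎

-- The numbers m_{u/(u+1)}

-- Truncated subtraction: exact whenever x ≤ y and 1 ≤ y, which fanNumber-growth provides.
jump : ℕ → ℕ → ℕ
jump x y = 17 * y ∸ x ∸ 3

fanNumber : ℕ → ℕ
fanNumber 0 = 1
fanNumber 1 = 13
fanNumber (suc (suc n)) = jump (fanNumber n) (fanNumber (suc n))

module _ {x y : ℕ} (y≥1 : 1 ≤ y) (x≤y : x ≤ y) where

  private
    room : y + (x + 3) ≤ 17 * y
    room = begin
      y + (x + 3)      ≤⟨ +-monoʳ-≤ y (+-mono-≤ x≤y (*-monoʳ-≤ 3 y≥1)) ⟩
      y + (y + 3 * y)  ≡⟨ solve (y ∷ []) ⟩
      5 * y            ≤⟨ *-monoˡ-≤ y (m≤m+n 5 12) ⟩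
      17 * y           ∎
      where open ≤-Reasoning

  jump-sum : jump x y + x + 3 ≡ 17 * y
  jump-sum = begin
    17 * y ∸ x ∸ 3 + x + 3       ≡⟨ +-assoc (17 * y ∸ x ∸ 3) x 3 ⟩
    17 * y ∸ x ∸ 3 + (x + 3)     ≡⟨ cong (_+ (x + 3)) (∸-+-assoc (17 * y) x 3) ⟩
    17 * y ∸ (x + 3) + (x + 3)   ≡⟨ m∸n+n≡m (m+n≤o⇒n≤o y room) ⟩
    17 * y                       ∎
    where open ≡-Reasoning

  jump-increasing : y ≤ jump x y
  jump-increasing = subst (y ≤_) (sym (∸-+-assoc (17 * y) x 3)) (m+n≤o⇒m≤o∸n y room)

fanNumber-growth : ∀ n → 1 ≤ fanNumber n × fanNumber n ≤ fanNumber (suc n)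
fanNumber-growth zero = s≤s z≤n , s≤s z≤n
fanNumber-growth (suc n) with fanNumber-growth n
... | pos , mono = ≤-trans pos mono , jump-increasing (≤-trans pos mono) mono

fanNumber-recurrence : ∀ n → fanNumber (suc (suc n)) + fanNumber n + 3 ≡ 17 * fanNumber (suc n)
fanNumber-recurrence n with fanNumber-growth n
... | pos , mono = jump-sum (≤-trans pos mono) mono

recurrence⇒vieta-sum : ∀ {x y w} → w + x + 3 ≡ 17 * y → w + x + y + 3 ≡ 6 * y * 3
recurrence⇒vieta-sum {x} {y} {w} recurrence = begin
  w + x + y + 3     ≡⟨ solve (x ∷ y ∷ w ∷ []) ⟩
  (w + x + 3) + y   ≡⟨ cong (_+ y) recurrence ⟩
  17 * y + y        ≡⟨ solve (y ∷ []) ⟩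
  6 * y * 3         ∎
  where open ≡-Reasoning

fanNumber-vieta-sum : ∀ n →
  fanNumber (suc (suc n)) + fanNumber n + fanNumber (suc n) + 3 ≡ 6 * fanNumber (suc n) * 3
fanNumber-vieta-sum n =
  recurrence⇒vieta-sum {fanNumber n} {fanNumber (suc n)} {fanNumber (suc (suc n))}
    (fanNumber-recurrence n)

fanNumber-markov : ∀ n → Markov (fanNumber n) (fanNumber (suc n)) 3
fanNumber-markov zero    = markov refl
fanNumber-markov (suc n) = Markov-swap (vieta-markov (fanNumber-vieta-sum n) (fanNumber-markov n))

fanNumber-newNum : ∀ n → newNum (fanNumber (suc n)) 3 (fanNumber n) ≡ fanNumber (suc (suc n))
fanNumber-newNum n =
  vieta-newNum (fanNumber-vieta-sum n) (fanNumber-markov n) (proj₁ (fanNumber-growth n))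

-- Fractions as pairs of naturals

Pair : Set
Pair = ℕ × ℕ

ι : Pair → Label
ι (p , q) = (ℤ.+ p , ℤ.+ q)

_⊕_ : Pair → Pair → Pair
(p , q) ⊕ (p′ , q′) = (p + p′ , q + q′)

_∥_ : Pair → Pair → Set
(p , q) ∥ (p′ , q′) = p * q′ ≡ q * p′

_≤ᶠ_ _<ᶠ_ : Pair → Pair → Set
(p , q) ≤ᶠ (p′ , q′) = p * q′ ≤ p′ * q
(p , q) <ᶠ (p′ , q′) = p * q′ < p′ * q

⊕-comm : ∀ P Q → P ⊕ Q ≡ Q ⊕ P
⊕-comm (p , q) (p′ , q′) = cong₂ _,_ (+-comm p p′) (+-comm q q′)

∥-sym : ∀ P Q → P ∥ Q → Q ∥ P
∥-sym (p , q) (p′ , q′) eq = trans (*-comm p′ q) (trans (sym eq) (*-comm p q′))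

≈F⇒∥ : ∀ P Q → ι P ≈F ι Q → P ∥ Q
≈F⇒∥ (p , q) (p′ , q′) eq =
  ℤ.+-injective (trans (ℤ.pos-* p q′) (trans eq (sym (ℤ.pos-* q p′))))

newLabel-⊕ : ∀ C D P → ¬ P ∥ (C ⊕ D) → newLabel (ι C) (ι D) (ι P) ≡ ι (C ⊕ D)
newLabel-⊕ (a , b) (c , d) (e , f) P∦C⊕D
  with ℤ.+ e ℤ.* (ℤ.+ b ℤ.+ ℤ.+ d) ℤ.≟ ℤ.+ f ℤ.* (ℤ.+ a ℤ.+ ℤ.+ c)
... | yes eq = ⊥-elim (P∦C⊕D (ℤ.+-injective (begin
  ℤ.+ (e * (b + d))              ≡⟨ pos-*-+ e b d ⟩
  ℤ.+ e ℤ.* (ℤ.+ b ℤ.+ ℤ.+ d)    ≡⟨ eq ⟩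
  ℤ.+ f ℤ.* (ℤ.+ a ℤ.+ ℤ.+ c)    ≡⟨ pos-*-+ f a c ⟨
  ℤ.+ (f * (a + c))              ∎)))
  where
  open ≡-Reasoning
  pos-*-+ : ∀ x y z → ℤ.+ (x * (y + z)) ≡ ℤ.+ x ℤ.* (ℤ.+ y ℤ.+ ℤ.+ z)
  pos-*-+ x y z = trans (ℤ.pos-* x (y + z)) (cong (ℤ.+ x ℤ.*_) (ℤ.pos-+ y z))
... | no _ = cong₂ _,_ (sym (ℤ.pos-+ a c)) (sym (ℤ.pos-+ b d))

record IsMediant (P Q R : Pair) : Set where
  constructor mediant
  field
    sum         : P ≡ Q ⊕ R
    independent : ¬ Q ∥ R

IsMediant-swap : ∀ {P Q R} → IsMediant P Q R → IsMediant P R Q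
IsMediant-swap {Q = Q} {R} (mediant P≡Q⊕R Q∦R) =
  mediant (trans P≡Q⊕R (⊕-comm Q R)) (Q∦R ∘ ∥-sym R Q)

∥-⊕ˡ : ∀ P Q → (P ⊕ Q) ∥ Q → P ∥ Q
∥-⊕ˡ (p , q) (p′ , q′) eq = +-cancelʳ-≡ (p′ * q′) _ _ (begin
  p * q′ + p′ * q′   ≡⟨ *-distribʳ-+ q′ p p′ ⟨
  (p + p′) * q′      ≡⟨ eq ⟩
  (q + q′) * p′      ≡⟨ *-distribʳ-+ p′ q q′ ⟩
  q * p′ + q′ * p′   ≡⟨ cong (q * p′ +_) (*-comm q′ p′) ⟩
  q * p′ + p′ * q′   ∎)
  where open ≡-Reasoning

∥-⊕²ʳ : ∀ P Q → P ∥ ((P ⊕ Q) ⊕ Q) → P ∥ Q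
∥-⊕²ʳ (p , q) (p′ , q′) eq = *-cancelˡ-≡ _ _ 2 (+-cancelˡ-≡ (p * q) _ _ (begin
  p * q + 2 * (p * q′)   ≡⟨ solve (p ∷ q ∷ q′ ∷ []) ⟩
  p * ((q + q′) + q′)    ≡⟨ eq ⟩
  q * ((p + p′) + p′)    ≡⟨ solve (p ∷ q ∷ p′ ∷ []) ⟩
  p * q + 2 * (q * p′)   ∎))
  where open ≡-Reasoning

mediant-flip : ∀ {P Q R} → IsMediant P Q R → ¬ Q ∥ (P ⊕ R) × IsMediant (P ⊕ R) P R
mediant-flip {Q = Q} {R} (mediant refl Q∦R) =
  Q∦R ∘ ∥-⊕²ʳ Q R , mediant refl (Q∦R ∘ ∥-⊕ˡ Q R)

mediant-flip′ : ∀ {P Q R} → IsMediant P Q R → ¬ Q ∥ (R ⊕ P) × IsMediant (R ⊕ P) R P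
mediant-flip′ {P} {Q} {R} P-mediant with mediant-flip P-mediant
... | Q∦P⊕R , P⊕R-mediant =
  subst (λ S → ¬ Q ∥ S × IsMediant S R P) (⊕-comm P R) (Q∦P⊕R , IsMediant-swap P⊕R-mediant)

mediantAt : (Fin 3 → Pair) → Fin 3 → Pair
mediantAt ℓ k = ℓ (other₁ k) ⊕ ℓ (other₂ k)

IsMediantAt : (Fin 3 → Pair) → Fin 3 → Set
IsMediantAt ℓ k = IsMediant (ℓ k) (ℓ (other₁ k)) (ℓ (other₂ k))

mediantAt-step : ∀ (ℓ : Fin 3 → Pair) {i} j → j ≢ i → IsMediantAt ℓ i →
                 ¬ ℓ j ∥ mediantAt ℓ j × IsMediantAt (update j (mediantAt ℓ j) ℓ) j
mediantAt-step ℓ {zero}           zero             0≢0 _ = contradiction refl 0≢0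
mediantAt-step ℓ {zero}           (suc zero)       _   m = mediant-flip m
mediantAt-step ℓ {zero}           (suc (suc zero)) _   m = mediant-flip (IsMediant-swap m)
mediantAt-step ℓ {suc zero}       zero             _   m = mediant-flip m
mediantAt-step ℓ {suc zero}       (suc zero)       1≢1 _ = contradiction refl 1≢1
mediantAt-step ℓ {suc zero}       (suc (suc zero)) _   m = mediant-flip′ (IsMediant-swap m)
mediantAt-step ℓ {suc (suc zero)} zero             _   m = mediant-flip′ m
mediantAt-step ℓ {suc (suc zero)} (suc zero)       _   m = mediant-flip′ (IsMediant-swap m)
mediantAt-step ℓ {suc (suc zero)} (suc (suc zero)) 2≢2 _ = contradiction refl 2≢2

≢⇒other≡ : ∀ {i j : Fin 3} → j ≢ i → other₁ j ≡ i ⊎ other₂ j ≡ i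
≢⇒other≡ {zero}           {zero}           0≢0 = contradiction refl 0≢0
≢⇒other≡ {zero}           {suc zero}       _   = inj₁ refl
≢⇒other≡ {zero}           {suc (suc zero)} _   = inj₁ refl
≢⇒other≡ {suc zero}       {zero}           _   = inj₁ refl
≢⇒other≡ {suc zero}       {suc zero}       1≢1 = contradiction refl 1≢1
≢⇒other≡ {suc zero}       {suc (suc zero)} _   = inj₂ refl
≢⇒other≡ {suc (suc zero)} {zero}           _   = inj₂ refl
≢⇒other≡ {suc (suc zero)} {suc zero}       _   = inj₂ refl
≢⇒other≡ {suc (suc zero)} {suc (suc zero)} 2≢2 = contradiction refl 2≢2

update-same : ∀ {A : Set} j (v : A) g → update j v g j ≡ v
update-same zero             v g = refl
update-same (suc zero)       v g = refl
update-same (suc (suc zero)) v g = refl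

update-pointwise : ∀ {A B : Set} (R : A → B → Set) j {a b g h} →
                   R a b → (∀ k → R (g k) (h k)) → ∀ k → R (update j a g k) (update j b h k)
update-pointwise R zero             Rab Rgh zero             = Rab
update-pointwise R zero             Rab Rgh (suc k)          = Rgh (suc k)
update-pointwise R (suc zero)       Rab Rgh zero             = Rgh zero
update-pointwise R (suc zero)       Rab Rgh (suc zero)       = Rab
update-pointwise R (suc zero)       Rab Rgh (suc (suc zero)) = Rgh (suc (suc zero))
update-pointwise R (suc (suc zero)) Rab Rgh zero             = Rgh zero
update-pointwise R (suc (suc zero)) Rab Rgh (suc zero)       = Rgh (suc zero)
update-pointwise R (suc (suc zero)) Rab Rgh (suc (suc zero)) = Rab

record Between (A B P : Pair) : Set where
  constructor between
  field
    lower : A ≤ᶠ P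
    upper : P ≤ᶠ B

record StrictlyBetween (A B P : Pair) : Set where
  constructor strictly-between
  field
    lower : A <ᶠ P
    upper : P <ᶠ B

⊕-strictly-betweenˡ : ∀ {A B P Q} → StrictlyBetween A B P → Between A B Q →
                      StrictlyBetween A B (P ⊕ Q)
⊕-strictly-betweenˡ {a₁ , a₂} {b₁ , b₂} {p₁ , p₂} {q₁ , q₂}
  (strictly-between A<P P<B) (between A≤Q Q≤B) = strictly-between
  (subst₂ _<_ (sym (*-distribˡ-+ a₁ p₂ q₂)) (sym (*-distribʳ-+ a₂ p₁ q₁)) (+-mono-<-≤ A<P A≤Q))
  (subst₂ _<_ (sym (*-distribʳ-+ b₂ p₁ q₁)) (sym (*-distribˡ-+ b₁ p₂ q₂)) (+-mono-<-≤ P<B Q≤B))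

⊕-strictly-betweenʳ : ∀ {A B P Q} → Between A B P → StrictlyBetween A B Q →
                      StrictlyBetween A B (P ⊕ Q)
⊕-strictly-betweenʳ {A} {B} {P} {Q} A≤P≤B A<Q<B =
  subst (StrictlyBetween A B) (⊕-comm Q P) (⊕-strictly-betweenˡ A<Q<B A≤P≤B)

mediant-strictly-between : ∀ A B → A <ᶠ B → StrictlyBetween A B (A ⊕ B)
mediant-strictly-between (a₁ , a₂) (b₁ , b₂) A<B = strictly-between lower upper
  where
  open ≤-Reasoning
  lower : a₁ * (a₂ + b₂) < (a₁ + b₁) * a₂
  lower = begin-strict
    a₁ * (a₂ + b₂)       ≡⟨ *-distribˡ-+ a₁ a₂ b₂ ⟩
    a₁ * a₂ + a₁ * b₂    <⟨ +-monoʳ-< (a₁ * a₂) A<B ⟩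
    a₁ * a₂ + b₁ * a₂    ≡⟨ *-distribʳ-+ a₂ a₁ b₁ ⟨
    (a₁ + b₁) * a₂       ∎
  upper : (a₁ + b₁) * b₂ < b₁ * (a₂ + b₂)
  upper = begin-strict
    (a₁ + b₁) * b₂       ≡⟨ *-distribʳ-+ b₂ a₁ b₁ ⟩
    a₁ * b₂ + b₁ * b₂    <⟨ +-monoˡ-< (b₁ * b₂) A<B ⟩
    b₁ * a₂ + b₁ * b₂    ≡⟨ *-distribˡ-+ b₁ a₂ b₂ ⟨
    b₁ * (a₂ + b₂)       ∎

<ᶠ-respʳ-∥ : ∀ A P Q .{{_ : NonZero (proj₂ Q)}} → P ∥ Q → A <ᶠ P → A <ᶠ Q
<ᶠ-respʳ-∥ (a₁ , a₂) (p₁ , p₂) (q₁ , q₂) P∥Q A<P =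
  *-cancelˡ-< p₂ (a₁ * q₂) (q₁ * a₂) (begin-strict
  p₂ * (a₁ * q₂)   ≡⟨ solve (a₁ ∷ p₂ ∷ q₂ ∷ []) ⟩
  a₁ * p₂ * q₂     <⟨ *-monoˡ-< q₂ A<P ⟩
  p₁ * a₂ * q₂     ≡⟨ solve (a₂ ∷ p₁ ∷ q₂ ∷ []) ⟩
  p₁ * q₂ * a₂     ≡⟨ cong (_* a₂) P∥Q ⟩
  p₂ * q₁ * a₂     ≡⟨ *-assoc p₂ q₁ a₂ ⟩
  p₂ * (q₁ * a₂)   ∎)
  where open ≤-Reasoning

<ᶠ-respˡ-∥ : ∀ B P Q .{{_ : NonZero (proj₂ Q)}} → P ∥ Q → P <ᶠ B → Q <ᶠ B
<ᶠ-respˡ-∥ (b₁ , b₂) (p₁ , p₂) (q₁ , q₂) P∥Q P<B =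
  *-cancelˡ-< p₂ (q₁ * b₂) (b₁ * q₂) (begin-strict
  p₂ * (q₁ * b₂)   ≡⟨ *-assoc p₂ q₁ b₂ ⟨
  p₂ * q₁ * b₂     ≡⟨ cong (_* b₂) P∥Q ⟨
  p₁ * q₂ * b₂     ≡⟨ solve (b₂ ∷ p₁ ∷ q₂ ∷ []) ⟩
  p₁ * b₂ * q₂     <⟨ *-monoˡ-< q₂ P<B ⟩
  b₁ * p₂ * q₂     ≡⟨ solve (b₁ ∷ p₂ ∷ q₂ ∷ []) ⟩
  p₂ * (b₁ * q₂)   ∎)
  where open ≤-Reasoning

strictly-between-resp-∥ : ∀ A B P Q .{{_ : NonZero (proj₂ Q)}} → P ∥ Q →
                          StrictlyBetween A B P → StrictlyBetween A B Q
strictly-between-resp-∥ A B P Q P∥Q (strictly-between A<P P<B) =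
  strictly-between (<ᶠ-respʳ-∥ A P Q P∥Q A<P) (<ᶠ-respˡ-∥ B P Q P∥Q P<B)

-- The fan of 1/1

fanLabel : ℕ → Pair
fanLabel u = (u , suc u)

fanLabel-<ᶠ : ∀ t → fanLabel t <ᶠ fanLabel (suc t)
fanLabel-<ᶠ t = ≤-reflexive square
  where
  square : suc (t * suc (suc t)) ≡ suc t * suc t
  square = solve (t ∷ [])

fanLabel-⊕-one : ∀ t → fanLabel t ⊕ (1 , 1) ≡ fanLabel (suc t)
fanLabel-⊕-one t = cong₂ _,_ (+-comm t 1) (+-comm (suc t) 1)

fanLabel-∥-injective : ∀ v u → fanLabel v ∥ fanLabel u → v ≡ u
fanLabel-∥-injective v u eq = +-cancelʳ-≡ (v * u) v u (trans (sym (*-suc v u)) eq)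

InFanGap : ℕ → Pair → Set
InFanGap t = StrictlyBetween (fanLabel t) (fanLabel (suc t))

no-fanLabel-in-gap : ∀ t u → ¬ InFanGap t (fanLabel u)
no-fanLabel-in-gap t u (strictly-between lower upper) = <⇒≱ t<u (s≤s⁻¹ u<1+t)
  where
  t<u : t < u
  t<u = +-cancelʳ-< (t * u) t u
    (subst₂ _<_ (*-suc t u) (trans (*-suc u t) (cong (u +_) (*-comm u t))) lower)
  u<1+t : u < suc t
  u<1+t = +-cancelʳ-< u u (suc t)
    (+-cancelʳ-< (u * t) (u + u) (suc t + u) (subst₂ _<_ lhs rhs upper))
    where
    lhs : u * suc (suc t) ≡ u + u + u * t
    lhs = solve (t ∷ u ∷ [])
    rhs : suc t * suc u ≡ suc t + u + u * t
    rhs = solve (t ∷ u ∷ [])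

Faithful : Pair → ℕ → Set
Faithful P m = ∀ u → P ∥ fanLabel u → m ≡ fanNumber u

fanLabel-faithful : ∀ v → Faithful (fanLabel v) (fanNumber v)
fanLabel-faithful v u eq = cong fanNumber (fanLabel-∥-injective v u eq)

one-faithful : ∀ {P} m → P ≡ (1 , 1) → Faithful P m
one-faithful m refl u eq =
  contradiction (trans (sym (*-identityˡ (suc u))) (trans eq (*-identityˡ u))) 1+n≢n

infinity-faithful : ∀ m → Faithful (1 , 0) m
infinity-faithful m u ()

gap-faithful : ∀ t P m → InFanGap t P → Faithful P m
gap-faithful t P m t<P<1+t u P∥u = contradiction
  (strictly-between-resp-∥ (fanLabel t) (fanLabel (suc t)) P (fanLabel u) P∥u t<P<1+t)
  (no-fanLabel-in-gap t u)

data Near (t : ℕ) : Pair → ℕ → Set where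
  left   : Near t (fanLabel t) (fanNumber t)
  right  : Near t (fanLabel (suc t)) (fanNumber (suc t))
  inside : ∀ {P m} → InFanGap t P → Near t P m

near-left : ∀ {t P m} → P ≡ fanLabel t → m ≡ fanNumber t → Near t P m
near-left refl refl = left

near-right : ∀ {t P m} → P ≡ fanLabel (suc t) → m ≡ fanNumber (suc t) → Near t P m
near-right refl refl = right

Near⇒Between : ∀ {t P m} → Near t P m → Between (fanLabel t) (fanLabel (suc t)) P
Near⇒Between {t} left  = between ≤-refl (<⇒≤ (fanLabel-<ᶠ t))
Near⇒Between {t} right = between (<⇒≤ (fanLabel-<ᶠ t)) ≤-refl
Near⇒Between (inside (strictly-between t<P P<1+t)) = between (<⇒≤ t<P) (<⇒≤ P<1+t)

Near⇒Faithful : ∀ {t P m} → Near t P m → Faithful P m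
Near⇒Faithful {t} left  = fanLabel-faithful t
Near⇒Faithful {t} right = fanLabel-faithful (suc t)
Near⇒Faithful {t} {P} {m} (inside t<P<1+t) = gap-faithful t P m t<P<1+t

-- On the fan, pos-1/1 holds 1/1 and the other two positions form a rim pair.
data Rim : Fin 3 → Fin 3 → Set where
  rim₀ : Rim zero (suc zero)
  rim₁ : Rim (suc zero) zero

data Phase (ℓ : Fin 3 → Pair) (n : Fin 3 → ℕ) (i : Fin 3) : Set where
  on-fan  : ∀ {p} t → Rim i p →
            ℓ i ≡ fanLabel (suc t) → n i ≡ fanNumber (suc t) →
            ℓ p ≡ fanLabel t → n p ≡ fanNumber t →
            ℓ pos-1/1 ≡ (1 , 1) → n pos-1/1 ≡ 3 → Phase ℓ n i
  off-fan : ∀ t → (∀ k → Near t (ℓ k) (n k)) →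
            InFanGap t (ℓ i) → Phase ℓ n i

Phase⇒Faithful : ∀ {ℓ n i} → Phase ℓ n i → ∀ k → Faithful (ℓ k) (n k)
Phase⇒Faithful (off-fan t near _) k = Near⇒Faithful (near k)
Phase⇒Faithful (on-fan _ rim₀ ℓ₀ n₀ _ _ _ _) zero       = Near⇒Faithful (near-right ℓ₀ n₀)
Phase⇒Faithful (on-fan _ rim₀ _ _ ℓ₁ n₁ _ _) (suc zero) = Near⇒Faithful (near-left ℓ₁ n₁)
Phase⇒Faithful (on-fan _ rim₁ _ _ ℓ₀ n₀ _ _) zero       = Near⇒Faithful (near-left ℓ₀ n₀)
Phase⇒Faithful (on-fan _ rim₁ ℓ₁ n₁ _ _ _ _) (suc zero) = Near⇒Faithful (near-right ℓ₁ n₁)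
Phase⇒Faithful (on-fan _ _ _ _ _ _ ℓ₂ _) (suc (suc zero)) = one-faithful _ ℓ₂

fan-advance-label : ∀ {P C} t → P ≡ fanLabel (suc t) → C ≡ (1 , 1) →
                    P ⊕ C ≡ fanLabel (suc (suc t))
fan-advance-label t refl refl = fanLabel-⊕-one (suc t)

fan-advance-number : ∀ {x y z} t → x ≡ fanNumber (suc t) → y ≡ 3 → z ≡ fanNumber t →
                     newNum x y z ≡ fanNumber (suc (suc t))
fan-advance-number t refl refl refl = fanNumber-newNum t

leave-fan : ∀ {ℓ n} t m → Near t (ℓ zero) (n zero) → Near t (ℓ (suc zero)) (n (suc zero)) →
            InFanGap t (ℓ zero ⊕ ℓ (suc zero)) →
            Phase (update pos-1/1 (ℓ zero ⊕ ℓ (suc zero)) ℓ) (update pos-1/1 m n) pos-1/1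
leave-fan {ℓ} {n} t m near₀ near₁ inner = off-fan t near inner
  where
  near : ∀ k → Near t (update pos-1/1 (ℓ zero ⊕ ℓ (suc zero)) ℓ k) (update pos-1/1 m n k)
  near zero             = near₀
  near (suc zero)       = near₁
  near (suc (suc zero)) = inside inner

Phase-step : ∀ {ℓ n i} j → j ≢ i → Phase ℓ n i →
  Phase (update j (mediantAt ℓ j) ℓ)
        (update j (newNum (n (other₁ j)) (n (other₂ j)) (n j)) n) j
Phase-step {ℓ} {n} {i} j j≢i (off-fan t near inner) =
  off-fan t (update-pointwise (Near t) j (inside new) near)
    (subst (InFanGap t) (sym (update-same j _ ℓ)) new)
  where
  new : InFanGap t (mediantAt ℓ j)
  new with ≢⇒other≡ j≢i
  ... | inj₁ refl = ⊕-strictly-betweenˡ inner (Near⇒Between (near (other₂ j)))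
  ... | inj₂ refl = ⊕-strictly-betweenʳ (Near⇒Between (near (other₁ j))) inner
Phase-step (suc zero) _ (on-fan t rim₀ ℓ₀ n₀ ℓ₁ n₁ ℓ₂ n₂) =
  on-fan (suc t) rim₁ (fan-advance-label t ℓ₀ ℓ₂) (fan-advance-number t n₀ n₂ n₁)
    ℓ₀ n₀ ℓ₂ n₂
Phase-step zero _ (on-fan t rim₁ ℓ₁ n₁ ℓ₀ n₀ ℓ₂ n₂) =
  on-fan (suc t) rim₀ (fan-advance-label t ℓ₁ ℓ₂) (fan-advance-number t n₁ n₂ n₀)
    ℓ₁ n₁ ℓ₂ n₂
Phase-step (suc (suc zero)) _ (on-fan t rim₀ ℓ₀ n₀ ℓ₁ n₁ _ _) =
  leave-fan t _ (near-right ℓ₀ n₀) (near-left ℓ₁ n₁)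
    (subst (InFanGap t)
      (trans (⊕-comm (fanLabel t) (fanLabel (suc t))) (cong₂ _⊕_ (sym ℓ₀) (sym ℓ₁)))
      (mediant-strictly-between _ _ (fanLabel-<ᶠ t)))
Phase-step (suc (suc zero)) _ (on-fan t rim₁ ℓ₁ n₁ ℓ₀ n₀ _ _) =
  leave-fan t _ (near-left ℓ₀ n₀) (near-right ℓ₁ n₁)
    (subst (InFanGap t) (cong₂ _⊕_ (sym ℓ₀) (sym ℓ₁))
      (mediant-strictly-between _ _ (fanLabel-<ᶠ t)))
Phase-step zero       0≢0 (on-fan _ rim₀ _ _ _ _ _ _) = contradiction refl 0≢0
Phase-step (suc zero) 1≢1 (on-fan _ rim₁ _ _ _ _ _ _) = contradiction refl 1≢1

-- Reachable states

record Invariant (s : State) (i : Fin 3) : Set where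
  field
    ℓ        : Fin 3 → Pair
    lab≡ι    : ∀ k → lab s k ≡ ι (ℓ k)
    mediantᵢ : IsMediantAt ℓ i
    phase    : Phase ℓ (num s) i

Invariant-step : ∀ {s i} j → j ≢ i → Invariant s i → Invariant (mutate j s) j
Invariant-step {s} j j≢i inv = record
  { ℓ        = update j (mediantAt ℓ j) ℓ
  ; lab≡ι    = update-pointwise (λ x P → x ≡ ι P) j newLabel≡ lab≡ι
  ; mediantᵢ = proj₂ (mediantAt-step ℓ j j≢i mediantᵢ)
  ; phase    = Phase-step j j≢i phase
  }
  where
  open Invariant inv
  newLabel≡ : newLabel (lab s (other₁ j)) (lab s (other₂ j)) (lab s j) ≡ ι (mediantAt ℓ j)
  newLabel≡ rewrite lab≡ι (other₁ j) | lab≡ι (other₂ j) | lab≡ι j =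
    newLabel-⊕ _ _ _ (proj₁ (mediantAt-step ℓ j j≢i mediantᵢ))

Invariant-state₂ : Invariant state₂ pos1/0
Invariant-state₂ = record
  { ℓ        = ℓ₂
  ; lab≡ι    = λ { zero → refl ; (suc zero) → refl ; (suc (suc zero)) → refl }
  ; mediantᵢ = mediant refl (λ ())
  ; phase    = on-fan 0 rim₁ refl refl refl refl refl refl
  }
  where
  ℓ₂ : Fin 3 → Pair
  ℓ₂ zero             = (0 , 1)
  ℓ₂ (suc zero)       = (1 , 2)
  ℓ₂ (suc (suc zero)) = (1 , 1)

ReachFrom⇒Invariant : ∀ {s i} → ReachFrom s i → Invariant s i
ReachFrom⇒Invariant base               = Invariant-state₂
ReachFrom⇒Invariant (step j reach j≢i) = Invariant-step j j≢i (ReachFrom⇒Invariant reach)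

≈F-faithful : ∀ P {m} → Faithful P m → ∀ u → ι P ≈F ι (fanLabel u) → m ≡ fanNumber u
≈F-faithful P faithful u = faithful u ∘ ≈F⇒∥ P (fanLabel u)

Reachable⇒fanNumber : ∀ {s} → Reachable s →
                      ∀ k u → lab s k ≈F ι (fanLabel u) → num s k ≡ fanNumber u
Reachable⇒fanNumber r-init zero             = ≈F-faithful (0 , 1) (fanLabel-faithful 0)
Reachable⇒fanNumber r-init (suc zero)       = ≈F-faithful (1 , 0) (infinity-faithful 1)
Reachable⇒fanNumber r-init (suc (suc zero)) u eq with () ← trans eq (ℤ.*-identityˡ (ℤ.+ u))
Reachable⇒fanNumber r-one  zero             = ≈F-faithful (0 , 1) (fanLabel-faithful 0)
Reachable⇒fanNumber r-one  (suc zero)       = ≈F-faithful (1 , 0) (infinity-faithful 1)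
Reachable⇒fanNumber r-one  (suc (suc zero)) = ≈F-faithful (1 , 1) (one-faithful 3 refl)
Reachable⇒fanNumber (r-more reach) k u eq =
  ≈F-faithful (ℓ k) (Phase⇒Faithful phase k) u (subst (_≈F ι (fanLabel u)) (lab≡ι k) eq)
  where open Invariant (ReachFrom⇒Invariant reach)

HasM⇒fanNumber : ∀ {u m} → HasM u (suc u) m → m ≡ fanNumber u
HasM⇒fanNumber {u} (s , reachable , k , eq , refl) = Reachable⇒fanNumber reachable k u eq

proposition4p12 : (q a b c : ℕ) → 3 ≤ q →
    HasM (q ∸ 1) q a → HasM (q ∸ 2) (q ∸ 1) b → HasM (q ∸ 3) (q ∸ 2) c →
    a + c + 3 ≡ 17 * b
proposition4p12 (suc (suc (suc r))) a b c _ ha hb hc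
  rewrite HasM⇒fanNumber ha | HasM⇒fanNumber hb | HasM⇒fanNumber hc = fanNumber-recurrence r
proposition4p12 (suc zero)       _ _ _ (s≤s ())       _ _ _
proposition4p12 (suc (suc zero)) _ _ _ (s≤s (s≤s ())) _ _ _
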